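{- For all positive integers $n$ and $k$, the triangular snake $T_n$ is a $k$-geometric mean graph.
   Context: For the path $u_1u_2\dots u_n$, the triangular snake $T_n$ is obtained by adding, for each $1\le i\le n-1$, a new vertex $v_i$ adjacent to both $u_i$ and $u_{i+1}$ (each edge of the path is replaced by a triangle). Let $k$ be a positive integer. A finite simple graph $G$ with $p$ vertices and $q$ edges is a $k$-geometric mean graph if there is an injection $\psi: V(G)\to\{k,k+1,\dots,k+q\}$ such that, when each edge $uv$ is assigned one of the labels $\lfloor\sqrt{\psi(u)\psi(v)}\rfloor$ or $\lceil\sqrt{\psi(u)\psi(v)}\rceil$ (chosen per edge), the resulting set of edge labels is exactly $\{k,k+1,\dots,k+q-1\}$. -}

module Defs where

open import Data.Nat using (ℕ; zero; suc; _+_; _*_; _∸_; _≤_; _<_; pred)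
open import Data.Fin using (Fin; inject₁) renaming (suc to fsuc)
open import Data.List using (List; []; _∷_; length; concatMap; lookup; allFin)
open import Data.Product using (Σ; _×_; _,_; ∃)
open import Data.Sum using (_⊎_; inj₁; inj₂)
open import Relation.Binary.PropositionalEquality using (_≡_)
open import Function.Definitions using (Injective)

-- A finite simple graph presented by a finite vertex type and a list of edges
-- (each edge an unordered pair, given as an ordered pair of distinct vertices,
-- listed once).  p = number of vertices, q = length of the edge list.
record Graph : Set₁ where
  field
    Vertex : Set
    edges  : List (Vertex × Vertex)

open Graph public

IsFloorSqrt : ℕ → ℕ → Set
IsFloorSqrt x r = (r * r ≤ x) × (x < suc r * suc r)

IsCeilSqrt : ℕ → ℕ → Set
IsCeilSqrt x r = (x ≤ r * r) × ((r ≡ 0) ⊎ Σ ℕ (λ s → (r ≡ suc s) × (s * s < x)))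

IsKGeometricMean : ℕ → Graph → Set
IsKGeometricMean k G =
  Σ (Vertex G → ℕ) λ ψ →
    Injective _≡_ _≡_ ψ
    × (∀ v → k ≤ ψ v × ψ v ≤ k + q)
    × Σ (Fin q → ℕ) λ lab →
        (∀ e → let (u , w) = lookup (edges G) e in
                 IsFloorSqrt (ψ u * ψ w) (lab e) ⊎ IsCeilSqrt (ψ u * ψ w) (lab e))
        × (∀ e → k ≤ lab e × lab e < k + q)
        × (∀ m → k ≤ m → m < k + q → ∃ λ e → lab e ≡ m)
  where
    q : ℕ
    q = length (edges G)

-- Triangular snake T_n: path u_1 … u_n (vertices inj₁ i, i : Fin n) and,
-- for each 1 ≤ i ≤ n-1, a vertex v_i (inj₂ i, i : Fin (n-1)) adjacent to
-- u_i and u_{i+1}.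
snakeEdges : (m : ℕ) → List ((Fin (suc m) ⊎ Fin m) × (Fin (suc m) ⊎ Fin m))
snakeEdges m = concatMap
  (λ i → (inj₁ (inject₁ i) , inj₁ (fsuc i))
       ∷ (inj₁ (inject₁ i) , inj₂ i)
       ∷ (inj₁ (fsuc i) , inj₂ i) ∷ [])
  (allFin m)

TriangularSnake : ℕ → Graph
TriangularSnake zero = record { Vertex = Fin zero ⊎ Fin zero ; edges = [] }
TriangularSnake (suc m) = record { Vertex = Fin (suc m) ⊎ Fin m ; edges = snakeEdges m }

module Submission where

-- Write u_0 … u_m for the path and v_i for the apex of the i-th triangle
-- (0 ≤ i < m), so q = 3m.  Label u_j by 3j + k and v_i by 3i + k + 2, and
-- give every edge the label ⌊√(ψu ψw)⌋.  With a = 3i + k the i-th triangle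
-- has the products a(a+3), a(a+2), (a+3)(a+2), which lie just above the
-- squares (a+1)², a², (a+2)²; so its three edge labels are a+1, a, a+2.
-- The triangles therefore use the labels k, k+1, …, k+3m-1, each once.

open import Defs
open import Data.Nat using (ℕ; zero; suc; _+_; _*_; _∸_; _≤_; _<_; z≤n; s≤s; _≤?_; _%_; _/_)
open import Data.Nat.Properties
open import Data.Nat.DivMod using (m≡m%n+[m/n]*n; m%n<n; m<n*o⇒m/o<n; m*n%n≡0; [m+kn]%n≡m%n)
open import Data.Nat.Solver using (module +-*-Solver)
open import Data.Fin using (Fin; toℕ; fromℕ<; inject₁) renaming (suc to fsuc)
open import Data.Fin.Properties using (toℕ-inject₁; toℕ-injective; toℕ-fromℕ<; toℕ<n)
open import Data.List using (List; []; _∷_; _++_; length; map; concatMap; lookup; allFin)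
open import Data.List.Properties using (length-tabulate; length-++; map-concatMap; concatMap-cong)
open import Data.List.Relation.Unary.All as All using (All)
import Data.List.Relation.Unary.Any as Any
import Data.List.Relation.Unary.All.Properties as All
import Data.List.Relation.Unary.Any.Properties as Any
open import Data.List.Membership.Propositional using (_∈_; lose)
open import Data.List.Membership.Propositional.Properties using (∈-allFin; ∈-lookup)
open import Data.Product using (_×_; _,_; proj₁; proj₂; ∃)
open import Data.Sum using (_⊎_; inj₁; inj₂)
open import Data.Empty using (⊥-elim)
open import Relation.Nullary using (yes; no)
open import Relation.Binary.PropositionalEquality
open import Function.Definitions using (Injective)

⌊√_⌋ : ℕ → ℕ
⌊√ zero ⌋ = zero
⌊√ suc x ⌋ with suc ⌊√ x ⌋ * suc ⌊√ x ⌋ ≤? suc x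
... | yes _ = suc ⌊√ x ⌋
... | no _  = ⌊√ x ⌋

⌊√⌋-correct : ∀ x → IsFloorSqrt x ⌊√ x ⌋
⌊√⌋-correct zero = z≤n , s≤s z≤n
⌊√⌋-correct (suc x) with ⌊√⌋-correct x
... | r²≤x , x<[1+r]² with suc ⌊√ x ⌋ * suc ⌊√ x ⌋ ≤? suc x
...   | yes [1+r]²≤1+x = [1+r]²≤1+x
                     , ≤-<-trans x<[1+r]² (*-mono-< (n<1+n (suc ⌊√ x ⌋)) (n<1+n (suc ⌊√ x ⌋)))
...   | no  [1+r]²≰1+x = m≤n⇒m≤1+n r²≤x , ≰⇒> [1+r]²≰1+x

isFloorSqrt-unique : ∀ {x r s} → IsFloorSqrt x r → IsFloorSqrt x s → r ≡ s
isFloorSqrt-unique {x} {r} {s} (r²≤x , x<[1+r]²) (s²≤x , x<[1+s]²) =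
  ≤-antisym (below r²≤x x<[1+s]²) (below s²≤x x<[1+r]²)
  where
  below : ∀ {a b} → a * a ≤ x → x < suc b * suc b → a ≤ b
  below {a} {b} a²≤x x<[1+b]² with a ≤? b
  ... | yes a≤b = a≤b
  ... | no  a≰b = ⊥-elim (<-irrefl refl
        (≤-<-trans (*-mono-≤ (≰⇒> a≰b) (≰⇒> a≰b)) (≤-<-trans a²≤x x<[1+b]²)))

⌊√⌋-near-square : ∀ x r d → x ≡ r * r + d → d ≤ r + r → ⌊√ x ⌋ ≡ r
⌊√⌋-near-square x r d refl d≤2r =
  isFloorSqrt-unique (⌊√⌋-correct x)
    (m≤m+n (r * r) d , s≤s (≤-trans (+-monoʳ-≤ (r * r) d≤2r) (≤-reflexive next-square)))
  where
  open +-*-Solver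
  next-square : r * r + (r + r) ≡ r + r * suc r
  next-square = solve 1 (λ r → r :* r :+ (r :+ r) := r :+ r :* (con 1 :+ r)) refl r

-- a(a+3) = (a+1)² + (a-1), which needs a ≥ 1.
⌊√a[3+a]⌋ : ∀ a → 1 ≤ a → ⌊√ a * (3 + a) ⌋ ≡ 1 + a
⌊√a[3+a]⌋ (suc b) _ = ⌊√⌋-near-square _ (2 + b) b
  (solve 1 (λ b → (con 1 :+ b) :* (con 4 :+ b) := (con 2 :+ b) :* (con 2 :+ b) :+ b) refl b)
  (≤-trans (m≤n+m b 2) (m≤m+n (2 + b) (2 + b)))
  where open +-*-Solver

⌊√a[2+a]⌋ : ∀ a → ⌊√ a * (2 + a) ⌋ ≡ a
⌊√a[2+a]⌋ a = ⌊√⌋-near-square _ a (a + a)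
  (solve 1 (λ a → a :* (con 2 :+ a) := a :* a :+ (a :+ a)) refl a) ≤-refl
  where open +-*-Solver

⌊√[3+a][2+a]⌋ : ∀ a → ⌊√ (3 + a) * (2 + a) ⌋ ≡ 2 + a
⌊√[3+a][2+a]⌋ a = ⌊√⌋-near-square _ (2 + a) (2 + a)
  (solve 1 (λ a → (con 3 :+ a) :* (con 2 :+ a) := (con 2 :+ a) :* (con 2 :+ a) :+ (con 2 :+ a)) refl a)
  (m≤m+n (2 + a) (2 + a))
  where open +-*-Solver

length-concatMap-const : ∀ {A B : Set} (f : A → List B) c →
  (∀ x → length (f x) ≡ c) → ∀ xs → length (concatMap f xs) ≡ length xs * c
length-concatMap-const f c len-f [] = refl
length-concatMap-const f c len-f (x ∷ xs) = begin
  length (f x ++ concatMap f xs)          ≡⟨ length-++ (f x) ⟩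
  length (f x) + length (concatMap f xs)  ≡⟨ cong₂ _+_ (len-f x) (length-concatMap-const f c len-f xs) ⟩
  c + length xs * c                       ∎
  where open ≡-Reasoning

-- The labels a+1, a, a+2 that one triangle of the snake receives.
consecutive : ℕ → List ℕ
consecutive a = 1 + a ∷ a ∷ 2 + a ∷ []

consecutive-in-range : ∀ {lo hi} a → lo ≤ a → 3 + a ≤ hi →
  All (λ x → lo ≤ x × x < hi) (consecutive a)
consecutive-in-range a lo≤a 3+a≤hi =
  (≤-trans lo≤a (n≤1+n a) , ≤-trans (n≤1+n _) 3+a≤hi)
  All.∷ (lo≤a , ≤-trans (≤-trans (n≤1+n _) (n≤1+n _)) 3+a≤hi)
  All.∷ (≤-trans lo≤a (≤-trans (n≤1+n a) (n≤1+n _)) , 3+a≤hi)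
  All.∷ All.[]

consecutive-covers : ∀ a r → r < 3 → r + a ∈ consecutive a
consecutive-covers a 0 _ = Any.there (Any.here refl)
consecutive-covers a 1 _ = Any.here refl
consecutive-covers a 2 _ = Any.there (Any.there (Any.here refl))
consecutive-covers a (suc (suc (suc r))) (s≤s (s≤s (s≤s ())))

floorLabel : {V : Set} → (V → ℕ) → V × V → ℕ
floorLabel ψ e = ⌊√ ψ (proj₁ e) * ψ (proj₂ e) ⌋

floorLabelling⇒kGeometricMean :
  (G : Graph) (k : ℕ) (ψ : Vertex G → ℕ) →
  Injective _≡_ _≡_ ψ →
  (∀ v → k ≤ ψ v × ψ v ≤ k + length (edges G)) →
  All (λ x → k ≤ x × x < k + length (edges G)) (map (floorLabel ψ) (edges G)) →
  (∀ x → k ≤ x → x < k + length (edges G) → x ∈ map (floorLabel ψ) (edges G)) →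
  IsKGeometricMean k G
floorLabelling⇒kGeometricMean G k ψ ψ-injective ψ-bounds labels-in-range labels-cover =
  ψ , ψ-injective , ψ-bounds , lab
    , (λ e → inj₁ (⌊√⌋-correct _))
    , (λ e → All.lookup (All.map⁻ labels-in-range) (∈-lookup {xs = edges G} e))
    , λ x k≤x x<k+q → hit (Any.map⁻ (labels-cover x k≤x x<k+q))
  where
  lab : Fin (length (edges G)) → ℕ
  lab e = floorLabel ψ (lookup (edges G) e)

  hit : ∀ {x} → Any.Any (λ e → x ≡ floorLabel ψ e) (edges G) → ∃ λ e → lab e ≡ x
  hit p = Any.index p , sym (Any.lookup-index p)
-- The labelling of the triangular snake with path u_0 … u_m and apexes v_0 … v_{m-1};
-- k ≥ 1 is needed only for the edge u_iu_{i+1} when i = 0.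
module Snake (m k : ℕ) (1≤k : 1 ≤ k) where

  SnakeVertex : Set
  SnakeVertex = Fin (suc m) ⊎ Fin m

  ψ : SnakeVertex → ℕ
  ψ (inj₁ j) = toℕ j * 3 + k
  ψ (inj₂ i) = 2 + (toℕ i * 3 + k)

  base : Fin m → ℕ
  base i = toℕ i * 3 + k

  triangle : Fin m → List (SnakeVertex × SnakeVertex)
  triangle i = (inj₁ (inject₁ i) , inj₁ (fsuc i))
             ∷ (inj₁ (inject₁ i) , inj₂ i)
             ∷ (inj₁ (fsuc i) , inj₂ i) ∷ []

  q : ℕ
  q = length (snakeEdges m)

  edge-count : q ≡ m * 3
  edge-count = begin
    length (concatMap triangle (allFin m)) ≡⟨ length-concatMap-const triangle 3 (λ _ → refl) (allFin m) ⟩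
    length (allFin m) * 3                  ≡⟨ cong (_* 3) (length-tabulate {n = m} (λ i → i)) ⟩
    m * 3                                  ∎
    where open ≡-Reasoning

  path-bound : ∀ {s} → s ≤ m → s * 3 + k ≤ k + q
  path-bound s≤m = ≤-trans (+-monoˡ-≤ k (*-monoˡ-≤ 3 s≤m))
                           (≤-reflexive (trans (+-comm (m * 3) k) (cong (k +_) (sym edge-count))))

  triangle-top : ∀ i → 3 + base i ≤ k + q
  triangle-top i = path-bound (toℕ<n i)

  ψ-bounds : ∀ v → k ≤ ψ v × ψ v ≤ k + q
  ψ-bounds (inj₁ j) = m≤n+m k _ , path-bound (≤-pred (toℕ<n j))
  ψ-bounds (inj₂ i) = ≤-trans (m≤n+m k _) (m≤n+m _ 2) , ≤-trans (n≤1+n _) (triangle-top i)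

  -- Path labels are ≡ k and apex labels ≡ k + 2 modulo 3.
  residues-differ : ∀ s t → s * 3 ≢ 2 + t * 3
  residues-differ s t eq
    with trans (sym (m*n%n≡0 s 3)) (trans (cong (_% 3) eq) ([m+kn]%n≡m%n 2 t 3))
  ... | ()

  shift-injective : ∀ {s t} → s * 3 + k ≡ t * 3 + k → s ≡ t
  shift-injective {s} {t} eq = *-cancelʳ-≡ s t 3 (+-cancelʳ-≡ k _ _ eq)

  ψ-injective : Injective _≡_ _≡_ ψ
  ψ-injective {inj₁ i} {inj₁ j} eq = cong inj₁ (toℕ-injective (shift-injective eq))
  ψ-injective {inj₁ i} {inj₂ j} eq = ⊥-elim (residues-differ (toℕ i) (toℕ j) (+-cancelʳ-≡ k _ _ eq))
  ψ-injective {inj₂ i} {inj₁ j} eq = ⊥-elim (residues-differ (toℕ j) (toℕ i) (+-cancelʳ-≡ k _ _ (sym eq)))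
  ψ-injective {inj₂ i} {inj₂ j} eq =
    cong inj₂ (toℕ-injective (shift-injective (suc-injective (suc-injective eq))))

  label : SnakeVertex × SnakeVertex → ℕ
  label = floorLabel ψ

  triangle-labels : ∀ i → map label (triangle i) ≡ consecutive (base i)
  triangle-labels i rewrite toℕ-inject₁ i =
    cong₂ _∷_ (⌊√a[3+a]⌋ (base i) (≤-trans 1≤k (m≤n+m k _)))
      (cong₂ _∷_ (⌊√a[2+a]⌋ (base i)) (cong (_∷ []) (⌊√[3+a][2+a]⌋ (base i))))

  labels : map label (snakeEdges m) ≡ concatMap (λ i → consecutive (base i)) (allFin m)
  labels = trans (map-concatMap label triangle (allFin m)) (concatMap-cong triangle-labels (allFin m))

  labels-in-range : All (λ x → k ≤ x × x < k + q) (map label (snakeEdges m))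
  labels-in-range = subst (All _) (sym labels) (All.concat⁺ (All.map⁺ (All.universal
    (λ i → consecutive-in-range (base i) (m≤n+m k _) (triangle-top i)) (allFin m))))

  -- x = r + (3t + k) with r = (x - k) mod 3 and t = (x - k) div 3 < m.
  labels-cover : ∀ x → k ≤ x → x < k + q → x ∈ map label (snakeEdges m)
  labels-cover x k≤x x<k+q = subst (x ∈_) (sym labels) (subst (_∈ _) r+base≡x
    (Any.concat⁺ (Any.map⁺ (lose (∈-allFin i) (consecutive-covers (base i) r (m%n<n y 3))))))
    where
    open ≡-Reasoning
    y r t : ℕ
    y = x ∸ k
    r = y % 3
    t = y / 3
    y<m*3 : y < m * 3
    y<m*3 = +-cancelʳ-< k y (m * 3)
      (subst₂ _<_ (sym (m∸n+n≡m k≤x)) (trans (cong (k +_) edge-count) (+-comm k (m * 3))) x<k+q)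
    t<m : t < m
    t<m = m<n*o⇒m/o<n y<m*3
    i : Fin m
    i = fromℕ< t<m
    r+base≡x : r + base i ≡ x
    r+base≡x = begin
      r + (toℕ i * 3 + k) ≡⟨ cong (λ s → r + (s * 3 + k)) (toℕ-fromℕ< t<m) ⟩
      r + (t * 3 + k)     ≡⟨ +-assoc r (t * 3) k ⟨
      (r + t * 3) + k     ≡⟨ cong (_+ k) (m≡m%n+[m/n]*n y 3) ⟨
      y + k               ≡⟨ m∸n+n≡m k≤x ⟩
      x                   ∎

mainTheorem8 : (n k : ℕ) → 1 ≤ n → 1 ≤ k → IsKGeometricMean k (TriangularSnake n)
mainTheorem8 zero k () _
mainTheorem8 (suc m) k _ 1≤k =
  floorLabelling⇒kGeometricMean (TriangularSnake (suc m)) k ψ ψ-injective ψ-bounds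
    labels-in-range labels-cover
  where open Snake m k 1≤k
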